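{- Consider the two-way hashing scheme described in the context, with $n$ bins and $m$ items inserted one at a time, where the insertion algorithm's backward search is allowed to proceed to unlimited depth. Then the algorithm succeeds in inserting all $m$ items while keeping the load of every bin at most $2$ if and only if the graph $G$ (the multigraph on the $n$ bins whose $m$ edges are the bin-pairs of the $m$ items) has no subgraph whose density, i.e. the ratio of its number of edges to its number of vertices, is greater than $2$.
   Context: Hashing model: there are $n$ bins. Items are inserted one at a time; each item is associated with two distinct bins, its pair chosen independently and uniformly at random among the $\binom{n}{2}$ pairs of distinct bins, and is stored in one of its two bins. The graph $G$ is the multigraph on vertex set the bins whose edges are the bin-pairs of the items. At any time, orient the edge of each stored item from the bin not holding it towards the bin holding it; the load of a bin is the number of items stored in it, i.e. its in-degree. Insertion algorithm: to insert an item with bins $U_1,U_2$, perform a breadth-first "backward search" starting from $U_1$ and $U_2$, where from a bin $X$ one may go to a bin $Y$ whenever there is a directed edge $Y\to X$ (an item stored in $X$ whose other bin is $Y$); for each visited bin at most $2$ such bins $Y$ are explored. The search looks for a bin $W$ with load at most $1$. If $W$ is reached from, say, $U_1$ along $U_1=X_0, X_1,\dots,X_k=W$ with directed edges $X_{j+1}\to X_j$, the new item is placed in $U_1$ and for each $j$ the item on edge $X_{j+1}\to X_j$ is moved from $X_j$ to $X_{j+1}$ (reversing that edge), so that only the load of $W$ increases, by one. If no such $W$ is found, the insertion fails. -}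

module Defs where

open import Data.Nat using (ℕ; zero; suc; _*_; _<_; _≤_)
open import Data.Fin using (Fin; toℕ)
open import Data.Fin.Properties using (_≟_)
open import Data.Fin.Subset using (Subset; _∈_; ∣_∣)
open import Data.List using (List; []; _∷_; _∷ʳ_; length; lookup; filter)
open import Data.List.Relation.Unary.Unique.Propositional using (Unique)
open import Data.Maybe using (Maybe; just; nothing)
open import Data.Product using (Σ; ∃; ∃-syntax; _×_; _,_; proj₁; proj₂)
open import Data.Sum using (_⊎_)
open import Relation.Binary.PropositionalEquality using (_≡_; _≢_)

-- A directed edge (tail , head): the item is stored in `head`,
-- its other bin is `tail`.
DEdge : ℕ → Set
DEdge n = Fin n × Fin n

-- The state of the table: the oriented edges of the stored items,
-- in insertion order.
State : ℕ → Set
State n = List (DEdge n)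

load : ∀ {n} → State n → Fin n → ℕ
load s X = length (filter (λ d → proj₂ d ≟ X) s)

flip : ∀ {n} → DEdge n → DEdge n
flip (a , b) = (b , a)

reverseAt : ∀ {n} → ℕ → State n → State n
reverseAt i       []       = []
reverseAt zero    (d ∷ ds) = flip d ∷ ds
reverseAt (suc i) (d ∷ ds) = d ∷ reverseAt i ds

data BPath {n} (s : State n) : Fin n → Fin n → Set where
  here  : ∀ {X} → BPath s X X
  there : ∀ {X Y W} (i : Fin (length s)) → lookup s i ≡ (Y , X) →
          BPath s Y W → BPath s X W

vertices : ∀ {n} {s : State n} {X W} → BPath s X W → List (Fin n)
vertices {X = X} here          = X ∷ []
vertices {X = X} (there i _ p) = X ∷ vertices p

-- moving the items along the path: reverse every edge of the path
reversePath : ∀ {n} {s : State n} {X W} → BPath s X W → State n → State n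
reversePath here          t = t
reversePath (there i _ p) t = reversePath p (reverseAt (toℕ i) t)

-- The search reaches a bin W of load ≤ 1 along a
-- (simple) backward path from u₁ (or u₂); the new item is placed in u₁
-- (resp. u₂) and the items on the path are moved one step along it.
data Insert {n} (s : State n) : Fin n × Fin n → Maybe (State n) → Set where
  place₁ : ∀ {u₁ u₂ W} (p : BPath s u₁ W) → Unique (vertices p) → load s W ≤ 1 →
           Insert s (u₁ , u₂) (just (reversePath p s ∷ʳ (u₂ , u₁)))
  place₂ : ∀ {u₁ u₂ W} (p : BPath s u₂ W) → Unique (vertices p) → load s W ≤ 1 →
           Insert s (u₁ , u₂) (just (reversePath p s ∷ʳ (u₁ , u₂)))
  fail   : ∀ {u₁ u₂} →
           (∀ W → (BPath s u₁ W ⊎ BPath s u₂ W) → 2 ≤ load s W) →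
           Insert s (u₁ , u₂) nothing

data Run {n} : State n → List (Fin n × Fin n) → Maybe (State n) → Set where
  done : ∀ {s} → Run s [] (just s)
  step : ∀ {s s₁ e es r} → Insert s e (just s₁) → Run s₁ es r → Run s (e ∷ es) r
  stop : ∀ {s e es} → Insert s e nothing → Run s (e ∷ es) nothing

Succeeds : ∀ {n} → Maybe (State n) → Set
Succeeds {n} (just s) = ∀ (X : Fin n) → load s X ≤ 2
Succeeds nothing      = Data.Empty.⊥
  where import Data.Empty

Distinct : ∀ {n} → Fin n × Fin n → Set
Distinct (a , b) = a ≢ b

HasDenseSubgraph : ∀ {n} → List (Fin n × Fin n) → Set
HasDenseSubgraph {n} items =
  Σ (Subset n) λ S → Σ (Subset (length items)) λ E →
    (∀ i → i ∈ E → proj₁ (lookup items i) ∈ S × proj₂ (lookup items i) ∈ S) ×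
    (2 * ∣ S ∣ < ∣ E ∣)

-- A successful insertion reverses a simple backward path ending at a bin W of load ≤ 1, which
-- changes only the loads of the two ends of the path; so placing the new item raises only the
-- load of W, and the stored orientation of the inserted items keeps every in-degree ≤ 2.
-- Then every subgraph (S , E) has |E| ≤ #(items stored in S) = Σ_{X ∈ S} load X ≤ 2|S|.
-- If an insertion fails, let T be the set of bins reachable backwards from the new item's
-- bins: every item stored in T has both bins in T and every bin of T has load ≥ 2, so these
-- items together with the new one span more than 2|T| edges on T.
module Submission where

open import Defs
open import Data.Bool.Base using (true; false; if_then_else_)
open import Data.Fin using (Fin; zero; suc; toℕ)
open import Data.Fin.Properties using (_≟_; toℕ-injective)
open import Data.Fin.Subset using (Subset; inside; outside; _∈_; _∉_; _⊆_; _∪_; ⁅_⁆; ∣_∣)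
open import Data.Fin.Subset.Properties
  using (_∈?_; ∉⊥; x∈⁅x⁆; x∈⁅y⁆⇒x≡y; ∣⁅x⁆∣≡1; x∈p∪q⁺; x∈p∪q⁻; p⊆p∪q; p⊂q⇒∣p∣<∣q∣; ∣p∣≤n)
open import Data.List using (List; []; _∷_; _++_; _∷ʳ_; length; lookup; filter)
open import Data.List.Properties using (++-assoc; ++-identityʳ)
open import Data.List.Relation.Binary.Pointwise using (Pointwise; []; _∷_; ++⁺)
open import Data.List.Relation.Unary.All as All using (All; []; _∷_)
open import Data.List.Relation.Unary.All.Properties using (¬Any⇒All¬)
open import Data.List.Relation.Unary.AllPairs using (_∷_)
open import Data.List.Relation.Unary.Any using (index; any?)
open import Data.List.Relation.Unary.Any.Properties using (lookup-index)
open import Data.List.Relation.Unary.Unique.Propositional using (Unique)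
open import Data.Maybe using (Maybe; just; nothing)
open import Data.Nat using (ℕ; zero; suc; _+_; _*_; _≤_; _<_; z≤n; s≤s)
open import Data.Nat.Properties
  using (+-commutativeSemigroup; +-comm; +-assoc; +-suc; +-identityʳ; *-suc; *-zeroʳ; +-mono-≤; +-monoʳ-≤;
         +-cancelʳ-≡; m≤n+m; m≤m+n; ≤-refl; ≤-trans; <⇒≱)
open import Algebra.Properties.CommutativeSemigroup +-commutativeSemigroup
  using (interchange; xy∙z≈xz∙y; xy∙z≈zy∙x)
open import Data.Product using (Σ; ∃-syntax; _×_; _,_; proj₁; proj₂)
open import Data.Sum using (_⊎_; inj₁; inj₂)
open import Data.Unit using (⊤; tt)
open import Data.Vec using ([]; _∷_; here; there)
open import Function using (_∘_)
open import Relation.Nullary using (Dec; does; yes; no; ¬_; ¬?; contradiction)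
open import Relation.Nullary.Decidable using (_×-dec_; decidable-stable)
open import Relation.Unary using (Pred; Decidable)
open import Relation.Binary.PropositionalEquality

𝟙 : ∀ {a} {A : Set a} → Dec A → ℕ
𝟙 a? = if does a? then 1 else 0

δ : ∀ {n} → Fin n → Fin n → ℕ
δ X Y = 𝟙 (X ≟ Y)

length-filter-∷ : ∀ {a p} {A : Set a} {P : Pred A p} (P? : Decidable P) x xs →
  length (filter P? (x ∷ xs)) ≡ 𝟙 (P? x) + length (filter P? xs)
length-filter-∷ P? x xs with does (P? x)
... | true  = refl
... | false = refl

load-∷ : ∀ {n} (d : DEdge n) t X → load (d ∷ t) X ≡ δ (proj₂ d) X + load t X
load-∷ d t X = length-filter-∷ (λ d → proj₂ d ≟ X) d t

load-∷ʳ : ∀ {n} (t : State n) d X → load (t ∷ʳ d) X ≡ load t X + δ (proj₂ d) X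
load-∷ʳ []       d X = trans (load-∷ d [] X) (+-comm (δ (proj₂ d) X) 0)
load-∷ʳ (d′ ∷ t) d X = begin
  load (d′ ∷ t ∷ʳ d) X                        ≡⟨ load-∷ d′ (t ∷ʳ d) X ⟩
  δ (proj₂ d′) X + load (t ∷ʳ d) X            ≡⟨ cong (δ (proj₂ d′) X +_) (load-∷ʳ t d X) ⟩
  δ (proj₂ d′) X + (load t X + δ (proj₂ d) X) ≡⟨ sym (+-assoc (δ (proj₂ d′) X) _ _) ⟩
  δ (proj₂ d′) X + load t X + δ (proj₂ d) X   ≡⟨ cong (_+ δ (proj₂ d) X) (sym (load-∷ d′ t X)) ⟩
  load (d′ ∷ t) X + δ (proj₂ d) X             ∎
  where open ≡-Reasoning

sumOver : ∀ {n} → Subset n → (Fin n → ℕ) → ℕ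
sumOver []            f = 0
sumOver (inside ∷ S)  f = f zero + sumOver S (f ∘ suc)
sumOver (outside ∷ S) f = sumOver S (f ∘ suc)

sumOver-cong : ∀ {n} (S : Subset n) {f g : Fin n → ℕ} → (∀ X → f X ≡ g X) → sumOver S f ≡ sumOver S g
sumOver-cong []            f≗g = refl
sumOver-cong (inside ∷ S)  f≗g = cong₂ _+_ (f≗g zero) (sumOver-cong S (f≗g ∘ suc))
sumOver-cong (outside ∷ S) f≗g = sumOver-cong S (f≗g ∘ suc)

sumOver-zero : ∀ {n} (S : Subset n) → sumOver S (λ _ → 0) ≡ 0
sumOver-zero []            = refl
sumOver-zero (inside ∷ S)  = sumOver-zero S
sumOver-zero (outside ∷ S) = sumOver-zero S

sumOver-+ : ∀ {n} (S : Subset n) (f g : Fin n → ℕ) → sumOver S (λ X → f X + g X) ≡ sumOver S f + sumOver S g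
sumOver-+ []            f g = refl
sumOver-+ (inside ∷ S)  f g = begin
  f zero + g zero + sumOver S (λ X → f (suc X) + g (suc X))
    ≡⟨ cong (f zero + g zero +_) (sumOver-+ S (f ∘ suc) (g ∘ suc)) ⟩
  f zero + g zero + (sumOver S (f ∘ suc) + sumOver S (g ∘ suc))
    ≡⟨ interchange (f zero) (g zero) _ _ ⟩
  f zero + sumOver S (f ∘ suc) + (g zero + sumOver S (g ∘ suc)) ∎
  where open ≡-Reasoning
sumOver-+ (outside ∷ S) f g = sumOver-+ S (f ∘ suc) (g ∘ suc)

sumOver-δ : ∀ {n} (S : Subset n) (h : Fin n) → sumOver S (δ h) ≡ 𝟙 (h ∈? S)
sumOver-δ (inside ∷ S)  zero    = cong suc (sumOver-zero S)
sumOver-δ (outside ∷ S) zero    = sumOver-zero S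
sumOver-δ (inside ∷ S)  (suc h) = sumOver-δ S h
sumOver-δ (outside ∷ S) (suc h) = sumOver-δ S h

sumOver-≤ : ∀ {n} (S : Subset n) (f : Fin n → ℕ) c → (∀ {X} → X ∈ S → f X ≤ c) → sumOver S f ≤ c * ∣ S ∣
sumOver-≤ []            f c bound = z≤n
sumOver-≤ (inside ∷ S)  f c bound rewrite *-suc c ∣ S ∣ =
  +-mono-≤ (bound here) (sumOver-≤ S (f ∘ suc) c (bound ∘ there))
sumOver-≤ (outside ∷ S) f c bound = sumOver-≤ S (f ∘ suc) c (bound ∘ there)

sumOver-≥ : ∀ {n} (S : Subset n) (f : Fin n → ℕ) c → (∀ {X} → X ∈ S → c ≤ f X) → c * ∣ S ∣ ≤ sumOver S f
sumOver-≥ []            f c bound rewrite *-zeroʳ c = z≤n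
sumOver-≥ (inside ∷ S)  f c bound rewrite *-suc c ∣ S ∣ =
  +-mono-≤ (bound here) (sumOver-≥ S (f ∘ suc) c (bound ∘ there))
sumOver-≥ (outside ∷ S) f c bound = sumOver-≥ S (f ∘ suc) c (bound ∘ there)

headsIn : ∀ {n} → Subset n → State n → ℕ
headsIn S t = length (filter (λ d → proj₂ d ∈? S) t)

sumOver-load : ∀ {n} (S : Subset n) (t : State n) → sumOver S (load t) ≡ headsIn S t
sumOver-load S []      = sumOver-zero S
sumOver-load S (d ∷ t) = begin
  sumOver S (load (d ∷ t))                              ≡⟨ sumOver-cong S (load-∷ d t) ⟩
  sumOver S (λ X → δ (proj₂ d) X + load t X)            ≡⟨ sumOver-+ S (δ (proj₂ d)) (load t) ⟩
  sumOver S (δ (proj₂ d)) + sumOver S (load t)          ≡⟨ cong₂ _+_ (sumOver-δ S (proj₂ d)) (sumOver-load S t) ⟩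
  𝟙 (proj₂ d ∈? S) + headsIn S t                       ≡⟨ sym (length-filter-∷ (λ d → proj₂ d ∈? S) d t) ⟩
  headsIn S (d ∷ t)                                     ∎
  where open ≡-Reasoning

headsIn-≤ : ∀ {n} (S : Subset n) (t : State n) c → (∀ {X} → X ∈ S → load t X ≤ c) → headsIn S t ≤ c * ∣ S ∣
headsIn-≤ S t c bound = subst (_≤ c * ∣ S ∣) (sumOver-load S t) (sumOver-≤ S (load t) c bound)

headsIn-≥ : ∀ {n} (S : Subset n) (t : State n) c → (∀ {X} → X ∈ S → c ≤ load t X) → c * ∣ S ∣ ≤ headsIn S t
headsIn-≥ S t c bound = subst (c * ∣ S ∣ ≤_) (sumOver-load S t) (sumOver-≥ S (load t) c bound)

Orientation : ∀ {n} → Fin n × Fin n → DEdge n → Set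
Orientation e d = d ≡ e ⊎ d ≡ flip e

Orients : ∀ {n} → List (Fin n × Fin n) → State n → Set
Orients = Pointwise Orientation

flip-orientation : ∀ {n} {e : Fin n × Fin n} {d} → Orientation e d → Orientation e (flip d)
flip-orientation (inj₁ refl) = inj₂ refl
flip-orientation (inj₂ refl) = inj₁ refl

reverseAt-orients : ∀ {n} {items : List (Fin n × Fin n)} {t} → Orients items t → ∀ k → Orients items (reverseAt k t)
reverseAt-orients []       k       = []
reverseAt-orients (o ∷ os) zero    = flip-orientation o ∷ os
reverseAt-orients (o ∷ os) (suc k) = o ∷ reverseAt-orients os k

reversePath-orients : ∀ {n} {items : List (Fin n × Fin n)} {s : State n} {X W} (p : BPath s X W) {t} →
  Orients items t → Orients items (reversePath p t)
reversePath-orients here          os = os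
reversePath-orients (there i _ p) os = reversePath-orients p (reverseAt-orients os (toℕ i))

_⟦_⟧ : ∀ {a} {A : Set a} → List A → ℕ → Maybe A
[]       ⟦ k     ⟧ = nothing
(x ∷ xs) ⟦ zero  ⟧ = just x
(x ∷ xs) ⟦ suc k ⟧ = xs ⟦ k ⟧

⟦toℕ⟧ : ∀ {a} {A : Set a} (xs : List A) (i : Fin (length xs)) → xs ⟦ toℕ i ⟧ ≡ just (lookup xs i)
⟦toℕ⟧ (x ∷ xs) zero    = refl
⟦toℕ⟧ (x ∷ xs) (suc i) = ⟦toℕ⟧ xs i

reverseAt-⟦⟧-≢ : ∀ {n} (t : State n) k j → j ≢ k → reverseAt k t ⟦ j ⟧ ≡ t ⟦ j ⟧
reverseAt-⟦⟧-≢ []      k       j       j≢k = refl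
reverseAt-⟦⟧-≢ (d ∷ t) zero    zero    j≢k = contradiction refl j≢k
reverseAt-⟦⟧-≢ (d ∷ t) zero    (suc j) j≢k = refl
reverseAt-⟦⟧-≢ (d ∷ t) (suc k) zero    j≢k = refl
reverseAt-⟦⟧-≢ (d ∷ t) (suc k) (suc j) j≢k = reverseAt-⟦⟧-≢ t k j (j≢k ∘ cong suc)

-- Reversing Y → X moves one item from X to Y; both sides are shifted so that no subtraction occurs.
reverseAt-load : ∀ {n} (t : State n) k {X Y} → t ⟦ k ⟧ ≡ just (Y , X) →
  ∀ Z → load (reverseAt k t) Z + δ X Z ≡ load t Z + δ Y Z
reverseAt-load ((Y , X) ∷ t) zero refl Z = begin
  load ((X , Y) ∷ t) Z + δ X Z   ≡⟨ cong (_+ δ X Z) (load-∷ (X , Y) t Z) ⟩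
  δ Y Z + load t Z + δ X Z       ≡⟨ xy∙z≈zy∙x (δ Y Z) (load t Z) (δ X Z) ⟩
  δ X Z + load t Z + δ Y Z       ≡⟨ cong (_+ δ Y Z) (sym (load-∷ (Y , X) t Z)) ⟩
  load ((Y , X) ∷ t) Z + δ Y Z   ∎
  where open ≡-Reasoning
reverseAt-load (d ∷ t) (suc k) {X} {Y} t⟦k⟧ Z = begin
  load (d ∷ reverseAt k t) Z + δ X Z ≡⟨ cong (_+ δ X Z) (load-∷ d (reverseAt k t) Z) ⟩
  h + load (reverseAt k t) Z + δ X Z ≡⟨ +-assoc h _ _ ⟩
  h + (load (reverseAt k t) Z + δ X Z) ≡⟨ cong (h +_) (reverseAt-load t k t⟦k⟧ Z) ⟩
  h + (load t Z + δ Y Z)             ≡⟨ sym (+-assoc h _ _) ⟩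
  h + load t Z + δ Y Z               ≡⟨ cong (_+ δ Y Z) (sym (load-∷ d t Z)) ⟩
  load (d ∷ t) Z + δ Y Z             ∎
  where
  open ≡-Reasoning
  h : ℕ
  h = δ (proj₂ d) Z

Intact : ∀ {n} {s : State n} {X W} → BPath s X W → State n → Set
Intact here          t = ⊤
Intact {s = s} (there i _ p) t = t ⟦ toℕ i ⟧ ≡ just (lookup s i) × Intact p t

intact-self : ∀ {n} {s : State n} {X W} (p : BPath s X W) → Intact p s
intact-self here                   = tt
intact-self {s = s} (there i _ p) = ⟦toℕ⟧ s i , intact-self p

-- The edges of p have their heads on p, so none of them is the edge i, whose head X is off p.
intact-reverseAt : ∀ {n} {s : State n} {X Y W} (i : Fin (length s)) → proj₂ (lookup s i) ≡ X →
  (p : BPath s Y W) → All (X ≢_) (vertices p) → ∀ {t} → Intact p t → Intact p (reverseAt (toℕ i) t)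
intact-reverseAt i head≡X here          _             _               = tt
intact-reverseAt i head≡X (there j eq p) (X≢Y ∷ X∉p) {t} (t⟦j⟧ , intact) =
  trans (reverseAt-⟦⟧-≢ t (toℕ i) (toℕ j) j≢i) t⟦j⟧ , intact-reverseAt i head≡X p X∉p intact
  where
  j≢i : toℕ j ≢ toℕ i
  j≢i j≡i with toℕ-injective j≡i
  ... | refl = X≢Y (trans (sym head≡X) (cong proj₂ eq))

reversePath-load : ∀ {n} {s : State n} {X W} (p : BPath s X W) → Unique (vertices p) →
  ∀ t → Intact p t → ∀ Z → load (reversePath p t) Z + δ X Z ≡ load t Z + δ W Z
reversePath-load here _ t _ Z = refl
reversePath-load {X = X} {W} (there {Y = Y} i eq p) (X∉p ∷ unique) t (t⟦i⟧ , intact) Z =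
  +-cancelʳ-≡ (δ Y Z) _ _ (begin
    load (reversePath p t′) Z + δ X Z + δ Y Z ≡⟨ xy∙z≈xz∙y _ (δ X Z) (δ Y Z) ⟩
    load (reversePath p t′) Z + δ Y Z + δ X Z ≡⟨ cong (_+ δ X Z) along-p ⟩
    load t′ Z + δ W Z + δ X Z                 ≡⟨ xy∙z≈xz∙y (load t′ Z) (δ W Z) (δ X Z) ⟩
    load t′ Z + δ X Z + δ W Z                 ≡⟨ cong (_+ δ W Z) first-edge ⟩
    load t Z + δ Y Z + δ W Z                  ≡⟨ xy∙z≈xz∙y (load t Z) (δ Y Z) (δ W Z) ⟩
    load t Z + δ W Z + δ Y Z                  ∎)
  where
  open ≡-Reasoning
  t′ = reverseAt (toℕ i) t
  first-edge : load t′ Z + δ X Z ≡ load t Z + δ Y Z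
  first-edge = reverseAt-load t (toℕ i) (trans t⟦i⟧ (cong just eq)) Z
  along-p : load (reversePath p t′) Z + δ Y Z ≡ load t′ Z + δ W Z
  along-p = reversePath-load p unique t′ (intact-reverseAt i (cong proj₂ eq) p X∉p intact) Z

placing-load : ∀ {n} {s : State n} {u W} (p : BPath s u W) → Unique (vertices p) →
  ∀ v X → load (reversePath p s ∷ʳ (v , u)) X ≡ load s X + δ W X
placing-load {s = s} p unique v X =
  trans (load-∷ʳ (reversePath p s) (v , _) X) (reversePath-load p unique s (intact-self p) X)

raise-≤2 : ∀ {n} {s : State n} {W} → load s W ≤ 1 → (∀ X → load s X ≤ 2) → ∀ X → load s X + δ W X ≤ 2
raise-≤2 {W = W} W≤1 ≤2 X with W ≟ X
... | yes refl = +-mono-≤ W≤1 (≤-refl {1})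
... | no  _    = subst (_≤ 2) (sym (+-identityʳ _)) (≤2 X)

insert-preserves : ∀ {n} {s s′ : State n} {e items} → Insert s e (just s′) →
  Orients items s → (∀ X → load s X ≤ 2) → Orients (items ∷ʳ e) s′ × (∀ X → load s′ X ≤ 2)
insert-preserves {s = s} (place₁ p unique W≤1) os ≤2 =
  ++⁺ (reversePath-orients p os) (inj₂ refl ∷ []) ,
  λ X → subst (_≤ 2) (sym (placing-load p unique _ X)) (raise-≤2 {s = s} W≤1 ≤2 X)
insert-preserves {s = s} (place₂ p unique W≤1) os ≤2 =
  ++⁺ (reversePath-orients p os) (inj₁ refl ∷ []) ,
  λ X → subst (_≤ 2) (sym (placing-load p unique _ X)) (raise-≤2 {s = s} W≤1 ≤2 X)

EdgesWithin : ∀ {n} → Subset n → (items : List (Fin n × Fin n)) → Subset (length items) → Set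
EdgesWithin S items E = ∀ i → i ∈ E → proj₁ (lookup items i) ∈ S × proj₂ (lookup items i) ∈ S

orientation-head∈ : ∀ {n} {S : Subset n} {e d} → Orientation e d → proj₁ e ∈ S × proj₂ e ∈ S → proj₂ d ∈ S
orientation-head∈ (inj₁ refl) (_ , b∈S) = b∈S
orientation-head∈ (inj₂ refl) (a∈S , _) = a∈S

orientation-ends∈ : ∀ {n} {S : Subset n} {e d} → Orientation e d → proj₁ d ∈ S → proj₂ d ∈ S →
  proj₁ e ∈ S × proj₂ e ∈ S
orientation-ends∈ (inj₁ refl) tail∈S head∈S = tail∈S , head∈S
orientation-ends∈ (inj₂ refl) tail∈S head∈S = head∈S , tail∈S

edgesWithin-≤-headsIn : ∀ {n} {items : List (Fin n × Fin n)} {t} (S : Subset n) → Orients items t →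
  (E : Subset (length items)) → EdgesWithin S items E → ∣ E ∣ ≤ headsIn S t
edgesWithin-≤-headsIn S [] [] _ = z≤n
edgesWithin-≤-headsIn S (_∷_ {y = d} o os) (inside ∷ E) within with proj₂ d ∈? S
... | yes _      = s≤s (edgesWithin-≤-headsIn S os E (λ i → within (suc i) ∘ there))
... | no  head∉S = contradiction (orientation-head∈ o (within zero here)) head∉S
edgesWithin-≤-headsIn S (_∷_ {y = d} {ys = t} o os) (outside ∷ E) within =
  ≤-trans (edgesWithin-≤-headsIn S os E (λ i → within (suc i) ∘ there))
          (subst (headsIn S t ≤_) (sym (length-filter-∷ (λ d → proj₂ d ∈? S) d t)) (m≤n+m _ _))

BackClosed : ∀ {n} → State n → Subset n → Set
BackClosed t S = All (λ d → proj₂ d ∈ S → proj₁ d ∈ S) t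

-- In a back-closed S every item stored in S has both bins in S, so it joins the edge set.
prepend-edgesWithin : ∀ {n} {xs ys : List (Fin n × Fin n)} {t} {S : Subset n} → Orients xs t → BackClosed t S →
  (F : Subset (length ys)) → EdgesWithin S ys F →
  Σ (Subset (length (xs ++ ys))) λ E → EdgesWithin S (xs ++ ys) E × ∣ E ∣ ≡ ∣ F ∣ + headsIn S t
prepend-edgesWithin [] [] F within = F , within , sym (+-identityʳ _)
prepend-edgesWithin {xs = x ∷ xs} {ys} {S = S} (_∷_ {y = d} o os) (closed ∷ closeds) F within
  with proj₂ d ∈? S | prepend-edgesWithin {ys = ys} os closeds F within
... | yes head∈S | E , withinE , ∣E∣ =
  inside ∷ E , withinCons , trans (cong suc ∣E∣) (sym (+-suc ∣ F ∣ _))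
  where
  withinCons : EdgesWithin S (x ∷ xs ++ ys) (inside ∷ E)
  withinCons zero    here      = orientation-ends∈ o (closed head∈S) head∈S
  withinCons (suc i) (there p) = withinE i p
... | no _ | E , withinE , ∣E∣ = outside ∷ E , withinCons , ∣E∣
  where
  withinCons : EdgesWithin S (x ∷ xs ++ ys) (outside ∷ E)
  withinCons (suc i) (there p) = withinE i p

snoc : ∀ {n} {s : State n} {X W Y} → BPath s X W → (i : Fin (length s)) → lookup s i ≡ (Y , W) → BPath s X Y
snoc here          i eq = there i eq here
snoc (there j e p) i eq = there j e (snoc p i eq)

-- Repeatedly add the tail of an item entering S from outside; the fuel k bounds how often
-- S can still grow, since ∣ S ∣ ≤ n.
backClosure : ∀ {n} (s : State n) (P : Fin n → Set) →
  (∀ i → P (proj₂ (lookup s i)) → P (proj₁ (lookup s i))) →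
  (S : Subset n) → (∀ {X} → X ∈ S → P X) →
  ∃[ T ] S ⊆ T × BackClosed s T × (∀ {X} → X ∈ T → P X)
backClosure {n} s P backwards S₀ inS₀ = grow n S₀ (m≤m+n n _) inS₀
  where
  grow : ∀ k S → n ≤ k + ∣ S ∣ → (∀ {X} → X ∈ S → P X) → ∃[ T ] S ⊆ T × BackClosed s T × (∀ {X} → X ∈ T → P X)
  grow k S fuel inS with any? (λ d → proj₂ d ∈? S ×-dec ¬? (proj₁ d ∈? S)) s
  ... | no noneEntering =
    S , (λ X∈S → X∈S) , All.map closes (¬Any⇒All¬ s noneEntering) , inS
    where
    closes : ∀ {d} → ¬ (proj₂ d ∈ S × proj₁ d ∉ S) → proj₂ d ∈ S → proj₁ d ∈ S
    closes {d} notEntering head∈S = decidable-stable (proj₁ d ∈? S) (λ tail∉S → notEntering (head∈S , tail∉S))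
  ... | yes entering = grow′ k fuel
    where
    i : Fin (length s)
    i = index entering
    Y : Fin n
    Y = proj₁ (lookup s i)
    S′ : Subset n
    S′ = S ∪ ⁅ Y ⁆
    grows : ∣ S ∣ < ∣ S′ ∣
    grows = p⊂q⇒∣p∣<∣q∣ (p⊆p∪q ⁅ Y ⁆ , Y , x∈p∪q⁺ (inj₂ (x∈⁅x⁆ Y)) , proj₂ (lookup-index entering))
    inS′ : ∀ {X} → X ∈ S′ → P X
    inS′ X∈S′ with x∈p∪q⁻ S ⁅ Y ⁆ X∈S′
    ... | inj₁ X∈S  = inS X∈S
    ... | inj₂ X∈⁅Y⁆ rewrite x∈⁅y⁆⇒x≡y Y X∈⁅Y⁆ = backwards i (inS (proj₁ (lookup-index entering)))
    grow′ : ∀ k → n ≤ k + ∣ S ∣ → ∃[ T ] S ⊆ T × BackClosed s T × (∀ {X} → X ∈ T → P X)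
    grow′ zero    fuel = contradiction fuel (<⇒≱ (≤-trans grows (∣p∣≤n S′)))
    grow′ (suc k) fuel with grow k S′ (≤-trans fuel (subst (_≤ k + ∣ S′ ∣) (+-suc k ∣ S ∣) (+-monoʳ-≤ k grows))) inS′
    ... | T , S′⊆T , closed , inT = T , S′⊆T ∘ p⊆p∪q ⁅ Y ⁆ , closed , inT

Reachable : ∀ {n} → State n → Fin n → Fin n → Fin n → Set
Reachable s u₁ u₂ X = BPath s u₁ X ⊎ BPath s u₂ X

reachable-backwards : ∀ {n} {s : State n} {u₁ u₂} i →
  Reachable s u₁ u₂ (proj₂ (lookup s i)) → Reachable s u₁ u₂ (proj₁ (lookup s i))
reachable-backwards i (inj₁ p) = inj₁ (snoc p i refl)
reachable-backwards i (inj₂ p) = inj₂ (snoc p i refl)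

reachable-start : ∀ {n} {s : State n} {u₁ u₂ X} → X ∈ ⁅ u₁ ⁆ ∪ ⁅ u₂ ⁆ → Reachable s u₁ u₂ X
reachable-start {u₁ = u₁} {u₂} X∈ with x∈p∪q⁻ ⁅ u₁ ⁆ ⁅ u₂ ⁆ X∈
... | inj₁ X∈⁅u₁⁆ rewrite x∈⁅y⁆⇒x≡y u₁ X∈⁅u₁⁆ = inj₁ here
... | inj₂ X∈⁅u₂⁆ rewrite x∈⁅y⁆⇒x≡y u₂ X∈⁅u₂⁆ = inj₂ here

newItem-edgesWithin : ∀ {n} {T : Subset n} {u₁ u₂} (es : List (Fin n × Fin n)) → u₁ ∈ T → u₂ ∈ T →
  EdgesWithin T ((u₁ , u₂) ∷ es) ⁅ zero ⁆
newItem-edgesWithin es u₁∈T u₂∈T zero    here      = u₁∈T , u₂∈T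
newItem-edgesWithin es u₁∈T u₂∈T (suc i) (there p) = contradiction p ∉⊥

-- T is the set of bins reachable backwards from u₁ or u₂; its edges are the items
-- stored in T together with the new item.
failure⇒dense : ∀ {n} {items : List (Fin n × Fin n)} {s : State n} {u₁ u₂} (es : List (Fin n × Fin n)) →
  Orients items s → (∀ W → Reachable s u₁ u₂ W → 2 ≤ load s W) →
  HasDenseSubgraph (items ++ (u₁ , u₂) ∷ es)
failure⇒dense {s = s} {u₁} {u₂} es os saturated =
  let T , start⊆T , closed , reachable =
        backClosure s (Reachable s u₁ u₂) reachable-backwards (⁅ u₁ ⁆ ∪ ⁅ u₂ ⁆) reachable-start
      E , within , ∣E∣ =
        prepend-edgesWithin os closed ⁅ zero ⁆
          (newItem-edgesWithin es (start⊆T (x∈p∪q⁺ (inj₁ (x∈⁅x⁆ u₁)))) (start⊆T (x∈p∪q⁺ (inj₂ (x∈⁅x⁆ u₂)))))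
      ∣E∣≡1+heads : ∣ E ∣ ≡ suc (headsIn T s)
      ∣E∣≡1+heads = trans ∣E∣ (cong (_+ headsIn T s) (∣⁅x⁆∣≡1 (zero {n = length es})))
  in T , E , within ,
     subst (2 * ∣ T ∣ <_) (sym ∣E∣≡1+heads) (s≤s (headsIn-≥ T s 2 (λ X∈T → saturated _ (reachable X∈T))))

bounded-loads⇒sparse : ∀ {n} {items : List (Fin n × Fin n)} {t : State n} → Orients items t →
  (∀ X → load t X ≤ 2) → ¬ HasDenseSubgraph items
bounded-loads⇒sparse {t = t} os ≤2 (S , E , within , dense) =
  <⇒≱ dense (≤-trans (edgesWithin-≤-headsIn S os E within) (headsIn-≤ S t 2 (λ {X} _ → ≤2 X)))

Outcome : ∀ {n} → Maybe (State n) → List (Fin n × Fin n) → Set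
Outcome (just s) items = Orients items s × (∀ X → load s X ≤ 2)
Outcome nothing  items = HasDenseSubgraph items

run-outcome : ∀ {n} {s : State n} {es r} → Run s es r → ∀ {items} → Orients items s →
  (∀ X → load s X ≤ 2) → Outcome r (items ++ es)
run-outcome done {items} os ≤2 = subst (λ xs → Orients xs _) (sym (++-identityʳ items)) os , ≤2
run-outcome (step {e = e} {es} {r} ins run) {items} os ≤2 =
  let os′ , ≤2′ = insert-preserves ins os ≤2
  in subst (Outcome r) (++-assoc items (e ∷ []) es) (run-outcome run os′ ≤2′)
run-outcome (stop {es = es} (fail saturated)) os ≤2 = failure⇒dense es os saturated

lemma3p1 : (n : ℕ) (items : List (Fin n × Fin n)) → All Distinct items →
    (r : Maybe (State n)) → Run [] items r →
    (Succeeds r → ¬ HasDenseSubgraph items) × (¬ HasDenseSubgraph items → Succeeds r)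
lemma3p1 n items _ (just s) run =
  let orients , ≤2 = run-outcome run [] (λ _ → z≤n)
  in (λ _ → bounded-loads⇒sparse orients ≤2) , (λ _ → ≤2)
lemma3p1 n items _ nothing run = (λ ()) , (λ sparse → sparse (run-outcome run [] (λ _ → z≤n)))
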